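{- Let $s\ge 2$ and let $w$ be a nonempty word over $\Sigma_s$ such that $\mathrm{core}_{a_{1,s}}(w)=w$. Then $\mathcal{G}(w)$ is connected and its diameter is at most $s+1$.
   Context: $\Sigma_s$ denotes the ordered alphabet $\{a_1<a_2<\dots<a_s\}$, and $a_{1,s}$ denotes the word $a_1a_2\cdots a_s$. For words $v,w$, $\mathrm{core}_v(w)$ is the subword of $w$ consisting of exactly those letters (occurrences) of $w$ that belong to at least one occurrence of $v$ as a (scattered) subword of $w$; equivalently, the shortest subword $w'$ of $w$ with $|w'|_v=|w|_v$, where $|u|_v$ is the number of occurrences of $v$ as a scattered subword of $u$. Thus $\mathrm{core}_{a_{1,s}}(w)=w$ means every letter of $w$ takes part in some occurrence of $a_1a_2\cdots a_s$ as a scattered subword of $w$. For a nonempty word $w=w_1\cdots w_n$ over $\Sigma_s$, the Parikh graph $\mathcal{G}(w)$ is the simple undirected graph on $\{1,\dots,n\}$ where, for $i<j$, $i$ and $j$ are adjacent iff $w_i=a_k$ and $w_j=a_{k+1}$ for some $1\le k\le s-1$. -}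

module Defs where

open import Data.Nat using (ℕ; zero; suc; _≤_; _+_)
open import Data.Fin using (Fin; toℕ) renaming (_<_ to _<ᶠ_)
open import Data.Vec using (Vec; lookup)
open import Data.Product using (Σ; ∃; _×_; _,_)
open import Data.Sum using (_⊎_)
open import Relation.Binary.PropositionalEquality using (_≡_)

-- The alphabet Σ_s = {a_1 < ... < a_s} is Fin s (a_k is the element with toℕ = k-1).
-- A word of length n over Σ_s is a Vec (Fin s) n; positions are Fin n.
Word : ℕ → ℕ → Set
Word s n = Vec (Fin s) n

record Occurrence {s n : ℕ} (w : Word s n) : Set where
  field
    pos        : Fin s → Fin n
    increasing : ∀ k l → k <ᶠ l → pos k <ᶠ pos l
    letters    : ∀ k → lookup w (pos k) ≡ k

-- core_{a_{1,s}}(w) = w : every letter (position) of w belongs to some occurrence.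
CoreIsWhole : {s n : ℕ} → Word s n → Set
CoreIsWhole {s} {n} w = ∀ (i : Fin n) → Σ (Occurrence w) λ o → ∃ λ k → Occurrence.pos o k ≡ i

ParikhArc : {s n : ℕ} → Word s n → Fin n → Fin n → Set
ParikhArc w i j = (i <ᶠ j) × (toℕ (lookup w j) ≡ suc (toℕ (lookup w i)))

ParikhAdj : {s n : ℕ} → Word s n → Fin n → Fin n → Set
ParikhAdj w i j = ParikhArc w i j ⊎ ParikhArc w j i

data Walk {V : Set} (R : V → V → Set) : V → V → ℕ → Set where
  here : ∀ {x} → Walk R x x 0
  step : ∀ {x y z k} → R x y → Walk R y z k → Walk R x z (suc k)

Connected : {V : Set} → (V → V → Set) → Set
Connected {V} R = ∀ (x y : V) → ∃ λ k → Walk R x y k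

DiameterAtMost : {V : Set} → (V → V → Set) → ℕ → Set
DiameterAtMost {V} R d = ∀ (x y : V) → ∃ λ k → k ≤ d × Walk R x y k

module Submission where

-- Every letter of w lies on an occurrence of a₁a₂⋯aₛ; such an occurrence,
-- read level by level, is a path a₁ — a₂ — ⋯ — aₛ in the Parikh graph G(w)
-- (a "chain").  For two occurrences o, o′ and each level m < s − 1 the
-- positions o(m) and o′(m+1) differ (they carry different letters), so either
-- o(m) < o′(m+1), an edge, or o′(m) < o′(m+1) < o(m), giving the edge
-- o′(m) — o(m+1).  Hence the two chains are joined by a "rung" between
-- consecutive levels everywhere.  To reach o′(l) from o(k) we step (at most once)
-- along o to an end of the rung at level k (or k − 1 when k is the top level),
-- cross it, and walk along o′: at most 1 + 1 + (s − 1) = s + 1 edges.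

open import Defs
open import Data.Nat using (ℕ; suc; _≤_; _<_; _+_; _∸_; z≤n; s≤s; s≤s⁻¹)
open import Data.Nat.Properties
  using (≤-refl; ≤-trans; ≤-total; ≤-reflexive; +-mono-≤; +-comm; m∸n≤m; m≤n⇒m<n∨m≡n; n≤1+n; n<1+n; 1+n≢n)
open import Data.Nat.DivMod using (_mod_; m<n⇒m%n≡m)
open import Data.Fin using (Fin; toℕ) renaming (_<_ to _<ᶠ_)
open import Data.Fin.Properties using (toℕ-fromℕ<; toℕ-injective; toℕ<n; <-cmp)
  renaming (<-trans to <ᶠ-trans)
open import Data.Vec using (lookup)
open import Data.Product using (∃; ∃₂; _×_; _,_; proj₂; map₂)
open import Data.Sum using (_⊎_; inj₁; inj₂; swap)
open import Data.Empty using (⊥-elim)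
open import Relation.Binary using (Symmetric; tri<; tri≈; tri>)
open import Relation.Binary.PropositionalEquality using (_≡_; refl; sym; trans; cong; subst₂)

module Ladders {V : Set} (R : V → V → Set) where

  Within : ℕ → V → V → Set
  Within d x y = ∃ λ k → k ≤ d × Walk R x y k

  _++ʷ_ : ∀ {x y z a b} → Walk R x y a → Walk R y z b → Walk R x z (a + b)
  here     ++ʷ q = q
  step r p ++ʷ q = step r (p ++ʷ q)

  -- Appending one edge at the end, keeping the length index a plain successor.
  snoc : ∀ {x y z k} → Walk R x y k → R y z → Walk R x z (suc k)
  snoc here       r = step r here
  snoc (step r p) q = step r (snoc p q)

  reverse : Symmetric R → ∀ {x y k} → Walk R x y k → Walk R y x k
  reverse sym-R here       = here
  reverse sym-R (step r p) = snoc (reverse sym-R p) (sym-R r)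

  within-refl : ∀ {d x} → Within d x x
  within-refl = 0 , z≤n , here

  within-edge : ∀ {x y} → R x y → Within 1 x y
  within-edge r = 1 , ≤-refl , step r here

  within-++ : ∀ {a b x y z} → Within a x y → Within b y z → Within (a + b) x z
  within-++ (k , k≤a , p) (l , l≤b , q) = k + l , +-mono-≤ k≤a l≤b , p ++ʷ q

  within-weaken : ∀ {a b x y} → a ≤ b → Within a x y → Within b x y
  within-weaken a≤b (k , k≤a , p) = k , ≤-trans k≤a a≤b , p

  Chain : ℕ → (ℕ → V) → Set
  Chain t f = ∀ k → suc k ≤ t → R (f k) (f (suc k))

  chain-tail : ∀ {t f} → Chain (suc t) f → Chain t (λ k → f (suc k))
  chain-tail c k k<t = c (suc k) (s≤s k<t)

  ascend : ∀ {t f a b} → Chain t f → a ≤ b → b ≤ t → Walk R (f a) (f b) (b ∸ a)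
  ascend c z≤n       z≤n       = here
  ascend c z≤n       (s≤s b≤t) = step (c 0 (s≤s z≤n)) (ascend (chain-tail c) z≤n b≤t)
  ascend c (s≤s a≤b) (s≤s b≤t) = ascend (chain-tail c) a≤b b≤t

  chain-within : Symmetric R → ∀ {t f a b} → Chain t f → a ≤ t → b ≤ t → Within t (f a) (f b)
  chain-within sym-R {a = a} {b} c a≤t b≤t with ≤-total a b
  ... | inj₁ a≤b = b ∸ a , ≤-trans (m∸n≤m b a) b≤t , ascend c a≤b b≤t
  ... | inj₂ b≤a = a ∸ b , ≤-trans (m∸n≤m a b) a≤t , reverse sym-R (ascend c b≤a a≤t)

  Rungs : ℕ → (ℕ → V) → (ℕ → V) → Set
  Rungs t f g = ∀ m → suc m ≤ t → R (f m) (g (suc m)) ⊎ R (g m) (f (suc m))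

  near-rung : Symmetric R → ∀ {u f k} → Chain (suc u) f → k ≤ suc u →
    ∃ λ m → suc m ≤ suc u × Within 1 (f k) (f m) × Within 1 (f k) (f (suc m))
  near-rung sym-R {u} {k = k} c k≤t with m≤n⇒m<n∨m≡n k≤t
  ... | inj₁ k<t  = k , k<t , within-refl , within-edge (c k k<t)
  ... | inj₂ refl = u , ≤-refl , within-edge (sym-R (c u ≤-refl)) , within-refl

  ladder-within : Symmetric R → ∀ {u f g k l} →
    Chain (suc u) f → Chain (suc u) g → Rungs (suc u) f g → k ≤ suc u → l ≤ suc u →
    Within (1 + (1 + suc u)) (f k) (g l)
  ladder-within sym-R cf cg rungs k≤t l≤t with near-rung sym-R cf k≤t
  ... | m , m<t , to-m , to-suc-m with rungs m m<t
  ...   | inj₁ r = within-++ to-m (within-++ (within-edge r) (chain-within sym-R cg m<t l≤t))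
  ...   | inj₂ r = within-++ to-suc-m
                     (within-++ (within-edge (sym-R r)) (chain-within sym-R cg (≤-trans (n≤1+n _) m<t) l≤t))

module Occurrences {u n : ℕ} (w : Word (suc (suc u)) n) where

  open Ladders (ParikhAdj w)

  s : ℕ
  s = suc (suc u)

  toℕ-mod : ∀ {k} → k < s → toℕ (k mod s) ≡ k
  toℕ-mod k<s = trans (toℕ-fromℕ< _) (m<n⇒m%n≡m k<s)

  -- The position of an occurrence at level k (0-based), i.e. of its letter a_{k+1};
  -- levels are read modulo s so that the map is total on ℕ.
  level : Occurrence w → ℕ → Fin n
  level o k = Occurrence.pos o (k mod s)

  level-letter : ∀ o {k} → k < s → toℕ (lookup w (level o k)) ≡ k
  level-letter o k<s = trans (cong toℕ (Occurrence.letters o _)) (toℕ-mod k<s)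

  level-increasing : ∀ o {k} → suc k < s → level o k <ᶠ level o (suc k)
  level-increasing o {k} k+1<s = Occurrence.increasing o _ _
    (subst₂ _<_ (sym (toℕ-mod (≤-trans (n≤1+n _) k+1<s))) (sym (toℕ-mod k+1<s)) (n<1+n k))

  level-arc : ∀ o o′ {k} → suc k < s → level o k <ᶠ level o′ (suc k) →
    ParikhArc w (level o k) (level o′ (suc k))
  level-arc o o′ k+1<s lt =
    lt , trans (level-letter o′ k+1<s) (cong suc (sym (level-letter o (≤-trans (n≤1+n _) k+1<s))))

  occurrence-chain : ∀ o → Chain (suc u) (level o)
  occurrence-chain o k k<t = inj₁ (level-arc o o (s≤s k<t) (level-increasing o (s≤s k<t)))

  -- Two occurrences are joined by rungs: level m of one and level m + 1 of the
  -- other carry different letters, so compare their positions.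
  occurrence-rungs : ∀ o o′ → Rungs (suc u) (level o) (level o′)
  occurrence-rungs o o′ m m<t with <-cmp (level o m) (level o′ (suc m))
  ... | tri< lt _ _ = inj₁ (inj₁ (level-arc o o′ (s≤s m<t) lt))
  ... | tri≈ _ eq _ = ⊥-elim (1+n≢n (same-letter eq))
    where
      -- equal positions would carry both a_{m+1} and a_{m+2}
      same-letter : level o m ≡ level o′ (suc m) → suc m ≡ m
      same-letter e = trans (sym (level-letter o′ (s≤s m<t)))
        (trans (cong (λ i → toℕ (lookup w i)) (sym e)) (level-letter o (≤-trans (n≤1+n _) (s≤s m<t))))
  ... | tri> _ _ gt = inj₂ (inj₁ (level-arc o′ o (s≤s m<t)
          (<ᶠ-trans (level-increasing o′ (s≤s m<t)) (<ᶠ-trans gt (level-increasing o (s≤s m<t))))))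

  on-some-level : CoreIsWhole w → ∀ i → ∃₂ λ o k → k ≤ suc u × level o k ≡ i
  on-some-level core i with core i
  ... | o , c , pos-c≡i =
    o , toℕ c , s≤s⁻¹ (toℕ<n c) ,
    trans (cong (Occurrence.pos o) (toℕ-injective (toℕ-mod (toℕ<n c)))) pos-c≡i

  diameter : CoreIsWhole w → DiameterAtMost (ParikhAdj w) (s + 1)
  diameter core i j with on-some-level core i | on-some-level core j
  ... | o , k , k≤t , refl | o′ , l , l≤t , refl =
    within-weaken (≤-reflexive (+-comm 1 s))
      (ladder-within swap (occurrence-chain o) (occurrence-chain o′) (occurrence-rungs o o′) k≤t l≤t)

lemma5p1 : (s n : ℕ) → 2 ≤ s → 1 ≤ n → (w : Word s n) → CoreIsWhole w →
    Connected (ParikhAdj w) × DiameterAtMost (ParikhAdj w) (s + 1)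
lemma5p1 (suc (suc u)) n (s≤s (s≤s z≤n)) _ w core =
  (λ i j → map₂ proj₂ (diameter i j)) , diameter
  where
    diameter : DiameterAtMost (ParikhAdj w) (suc (suc u) + 1)
    diameter = Occurrences.diameter w core
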